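{- Let $C$ be a code containing $a^n$ ($n\ge1$), let $t\ge1$, and for each $\omega\in C\setminus\{a^n\}$ let $i_1(\omega),\dots,i_t(\omega),j_1(\omega),\dots,j_t(\omega)\ge0$ be integers. Then the set $$\{a^{nt}\}\cup\bigsqcup_{\omega\in C\setminus\{a^n\}}\bigl\{a^{n i_s(\omega)}\,\omega\,a^{n(s-1+t\,j_s(\omega))}: s=1,\dots,t\bigr\}$$ is a prefix-suffix code over $C$.
   Context: Fix an alphabet $\mathcal A$ containing a letter $a$. A code is a set $X\subseteq\mathcal A^*$ such that $x_1\cdots x_t=y_1\cdots y_{t'}$ with $x_i,y_i\in X$ implies $t=t'$ and $x_i=y_i$ for all $i$. A set $C_1$ is a code over a code $C_2$ if $C_1\subseteq C_2^*$ and $C_1$, with its words regarded as words over the alphabet $C_2$ (via their unique factorizations), is a code; it is a prefix (resp. suffix) code over $C_2$ if moreover, as words over $C_2$, no word of $C_1$ is a proper prefix (resp. suffix) of another. Recursively, $C_1$ is a prefix-suffix code over $C_2$ if $C_1=C_2$ or $C_1$ is a prefix code or a suffix code over some prefix-suffix code over $C_2$. -}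

module Defs where

open import Data.Nat using (ℕ; _*_; _+_; _≥_)
open import Data.Fin using (Fin; toℕ)
open import Data.List using (List; []; _++_; concat; replicate)
open import Data.List.Relation.Unary.All using (All)
open import Data.Product using (Σ; _×_; ∃)
open import Data.Sum using (_⊎_)
open import Data.Empty using (⊥)
open import Relation.Binary.PropositionalEquality using (_≡_; _≢_)

Lang : Set → Set₁
Lang B = List B → Set

_⊆L_ : {B : Set} → Lang B → Lang B → Set
X ⊆L Y = ∀ w → X w → Y w

IsCode : {B : Set} → Lang B → Set
IsCode {B} X = (xs ys : List (List B)) → All X xs → All X ys →
               concat xs ≡ concat ys → xs ≡ ys

InStar : {B : Set} → Lang B → List B → Set
InStar {B} C₂ w = Σ (List (List B)) λ f → All C₂ f × concat f ≡ w

-- C₁ regarded as a set of words over the alphabet C₂: the C₂-factorizations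
-- of the words of C₁ (unique when C₂ is a code).
Over : {B : Set} → Lang B → Lang B → Lang (List B)
Over C₁ C₂ f = All C₂ f × C₁ (concat f)

IsCodeOver : {B : Set} → Lang B → Lang B → Set
IsCodeOver C₁ C₂ = (∀ w → C₁ w → InStar C₂ w) × IsCode (Over C₁ C₂)

ProperPrefix : {B : Set} → List B → List B → Set
ProperPrefix {B} u v = Σ (List B) λ r → r ≢ [] × u ++ r ≡ v

ProperSuffix : {B : Set} → List B → List B → Set
ProperSuffix {B} u v = Σ (List B) λ r → r ≢ [] × r ++ u ≡ v

IsPrefixCodeOver : {B : Set} → Lang B → Lang B → Set
IsPrefixCodeOver {B} C₁ C₂ = IsCodeOver C₁ C₂ ×
  ((f g : List (List B)) → Over C₁ C₂ f → Over C₁ C₂ g → ProperPrefix f g → ⊥)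

IsSuffixCodeOver : {B : Set} → Lang B → Lang B → Set
IsSuffixCodeOver {B} C₁ C₂ = IsCodeOver C₁ C₂ ×
  ((f g : List (List B)) → Over C₁ C₂ f → Over C₁ C₂ g → ProperSuffix f g → ⊥)

-- PSCode C₂ C₁ : C₁ is a prefix-suffix code over C₂ (recursive definition).
-- Set equality C₁ = C₂ is mutual inclusion of predicates.
data PSCode {B : Set} (C₂ : Lang B) : Lang B → Set₁ where
  base : ∀ {C₁} → C₁ ⊆L C₂ → C₂ ⊆L C₁ → PSCode C₂ C₁
  pre  : ∀ {D C₁} → PSCode C₂ D → IsPrefixCodeOver C₁ D → PSCode C₂ C₁
  suf  : ∀ {D C₁} → PSCode C₂ D → IsSuffixCodeOver C₁ D → PSCode C₂ C₁

pow : {B : Set} → B → ℕ → List B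
pow a k = replicate k a

-- The set {a^{nt}} ∪ ⋃_{ω ∈ C∖{aⁿ}} { a^{n i_s(ω)} ω a^{n(s-1+t j_s(ω))} : s = 1..t },
-- with s ∈ {1..t} encoded as s' : Fin t, s = toℕ s' + 1.
TheSet : {B : Set} (a : B) (C : Lang B) (n t : ℕ)
         (i j : List B → Fin t → ℕ) → Lang B
TheSet {B} a C n t i j w =
  w ≡ pow a (n * t) ⊎
  Σ (List B) λ ω → C ω × ω ≢ pow a n ×
    Σ (Fin t) λ s → w ≡ pow a (n * i ω s) ++ ω ++ pow a (n * (toℕ s + t * j ω s))

module Submission where

-- Over the code C, the word A = aⁿ is a single letter. Put Aᵗ = a^{nt} and
-- y(ω,s) = a^{n i_s(ω)} ω a^{n(s-1)}; over C these read Aᵗ and A^{i_s(ω)} ω A^{s-1}.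
-- The set Y of all Aᵗ and y(ω,s) is a suffix code over C: reading a C-factorization
-- from the right, the first letter other than A comes after s-1 < t letters A, and it
-- is ω, so ω and s, hence i_s(ω), are determined. Each word of the theorem's set is
-- Aᵗ or y(ω,s)·(Aᵗ)^{j_s(ω)}; over Y it is one letter followed by j_s(ω) letters Aᵗ,
-- and since the first letter determines ω and s, hence j_s(ω), these words form a
-- prefix code over Y. So the set is a prefix code over a suffix code over C.

open import Defs
open import Data.Nat using (ℕ; zero; suc; _+_; _*_; _<_; _≥_; s≤s)
open import Data.Nat.Properties using (*-zeroʳ; *-suc; *-assoc; *-distribˡ-+; *-mono-≤)
open import Data.Fin using (Fin; toℕ)
open import Data.Fin.Properties using (toℕ-injective; toℕ<n)
open import Data.List using (List; []; _∷_; _++_; [_]; concat; length; map; replicate; reverse)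
open import Data.List.Properties
  using (++-assoc; ++-identityʳ; ++-identityʳ-unique; ++-cancelˡ;
         ++-conicalˡ; ++-conicalʳ; ∷-injectiveˡ; ∷-injectiveʳ; concat-++; concat-concat;
         length-replicate; map-injective; reverse-++; reverse-injective; reverse-involutive;
         unfold-reverse)
open import Data.List.Relation.Unary.All as All using (All; []; _∷_)
open import Data.List.Relation.Unary.All.Properties using (++⁺; concat⁺; map⁺; replicate⁺)
open import Data.List.Relation.Unary.Any.Properties as Any using ()
open import Data.Product using (Σ-syntax; _×_; _,_; proj₁; proj₂)
open import Data.Sum using (_⊎_; inj₁; inj₂)
open import Data.Empty using (⊥; ⊥-elim)
open import Function using (_∘_)
open import Relation.Nullary using (¬_)
open import Relation.Binary.PropositionalEquality hiding ([_])

open ≡-Reasoning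

module _ {X : Set} where

  replicate-+ : ∀ m k (x : X) → replicate (m + k) x ≡ replicate m x ++ replicate k x
  replicate-+ zero    k x = refl
  replicate-+ (suc m) k x = cong (x ∷_) (replicate-+ m k x)

  concat-replicate : ∀ m k (x : X) → concat (replicate k (replicate m x)) ≡ replicate (m * k) x
  concat-replicate m zero    x = cong (λ l → replicate l x) (sym (*-zeroʳ m))
  concat-replicate m (suc k) x = begin
    replicate m x ++ concat (replicate k (replicate m x)) ≡⟨ cong (replicate m x ++_) (concat-replicate m k x) ⟩
    replicate m x ++ replicate (m * k) x                  ≡⟨ sym (replicate-+ m (m * k) x) ⟩
    replicate (m + m * k) x                               ≡⟨ cong (λ l → replicate l x) (sym (*-suc m k)) ⟩
    replicate (m * suc k) x                               ∎

  reverse-replicate : ∀ k (x : X) → reverse (replicate k x) ≡ replicate k x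
  reverse-replicate zero    x = refl
  reverse-replicate (suc k) x = begin
    reverse (x ∷ replicate k x)      ≡⟨ unfold-reverse x (replicate k x) ⟩
    reverse (replicate k x) ++ [ x ] ≡⟨ cong (_++ [ x ]) (reverse-replicate k x) ⟩
    replicate k x ++ [ x ]           ≡⟨ replicate-∷ʳ k ⟩
    x ∷ replicate k x                ∎
    where
    replicate-∷ʳ : ∀ k → replicate k x ++ [ x ] ≡ x ∷ replicate k x
    replicate-∷ʳ zero    = refl
    replicate-∷ʳ (suc k) = cong (x ∷_) (replicate-∷ʳ k)

  reverse-replicate-++-∷ : ∀ k (y x : X) m →
    reverse (replicate k x ++ y ∷ replicate m x) ≡ replicate m x ++ y ∷ replicate k x
  reverse-replicate-++-∷ k y x m = begin
    reverse (replicate k x ++ y ∷ replicate m x)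
      ≡⟨ reverse-++ (replicate k x) (y ∷ replicate m x) ⟩
    reverse (y ∷ replicate m x) ++ reverse (replicate k x)
      ≡⟨ cong₂ _++_ (unfold-reverse y (replicate m x)) (reverse-replicate k x) ⟩
    (reverse (replicate m x) ++ [ y ]) ++ replicate k x
      ≡⟨ cong (λ l → (l ++ [ y ]) ++ replicate k x) (reverse-replicate m x) ⟩
    (replicate m x ++ [ y ]) ++ replicate k x
      ≡⟨ ++-assoc (replicate m x) [ y ] (replicate k x) ⟩
    replicate m x ++ y ∷ replicate k x
      ∎

  ++-comparable : ∀ (u v u′ v′ : List X) → u ++ u′ ≡ v ++ v′ →
    (Σ[ r ∈ List X ] u ++ r ≡ v) ⊎ (Σ[ r ∈ List X ] v ++ r ≡ u)
  ++-comparable []      v       u′ v′ e = inj₁ (v , refl)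
  ++-comparable (x ∷ u) []      u′ v′ e = inj₂ (x ∷ u , refl)
  ++-comparable (x ∷ u) (y ∷ v) u′ v′ e with ∷-injectiveˡ e | ++-comparable u v u′ v′ (∷-injectiveʳ e)
  ... | refl | inj₁ (r , u++r≡v) = inj₁ (r , cong (x ∷_) u++r≡v)
  ... | refl | inj₂ (r , v++r≡u) = inj₂ (r , cong (x ∷_) v++r≡u)

module _ {X : Set} {x y : X} (y≢x : y ≢ x) where

  replicate≢replicate-++-∷ : ∀ k m w → replicate k x ≢ replicate m x ++ y ∷ w
  replicate≢replicate-++-∷ (suc k) zero    w e = y≢x (sym (∷-injectiveˡ e))
  replicate≢replicate-++-∷ (suc k) (suc m) w e = replicate≢replicate-++-∷ k m w (∷-injectiveʳ e)

  replicate-++≢replicate-++-∷ : ∀ {k m} u w → m < k → replicate k x ++ u ≢ replicate m x ++ y ∷ w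
  replicate-++≢replicate-++-∷ {suc k} {zero}  u w _         e = y≢x (sym (∷-injectiveˡ e))
  replicate-++≢replicate-++-∷ {suc k} {suc m} u w (s≤s m<k) e =
    replicate-++≢replicate-++-∷ u w m<k (∷-injectiveʳ e)

  replicate-++-∷-injective : ∀ {y′} → y′ ≢ x → ∀ k m u w →
    replicate k x ++ y ∷ u ≡ replicate m x ++ y′ ∷ w → k ≡ m × y ≡ y′ × u ≡ w
  replicate-++-∷-injective y′≢x zero    zero    u w e = refl , ∷-injectiveˡ e , ∷-injectiveʳ e
  replicate-++-∷-injective y′≢x zero    (suc m) u w e = ⊥-elim (y≢x (∷-injectiveˡ e))
  replicate-++-∷-injective y′≢x (suc k) zero    u w e = ⊥-elim (y′≢x (sym (∷-injectiveˡ e)))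
  replicate-++-∷-injective y′≢x (suc k) (suc m) u w e
    with replicate-++-∷-injective y′≢x k m u w (∷-injectiveʳ e)
  ... | k≡m , y≡y′ , u≡w = cong suc k≡m , y≡y′ , u≡w

PrefixFree : {X : Set} → Lang X → Set
PrefixFree L = ∀ u v → L u → L v → ProperPrefix u v → ⊥

SuffixFree : {X : Set} → Lang X → Set
SuffixFree L = ∀ u v → L u → L v → ProperSuffix u v → ⊥

module _ {X : Set} where

  ProperSuffix⇒ProperPrefix-reverse : {u v : List X} → ProperSuffix u v →
    ProperPrefix (reverse u) (reverse v)
  ProperSuffix⇒ProperPrefix-reverse {u} (r , r≢[] , r++u≡v) =
    reverse r , r≢[] ∘ reverse-injective , trans (sym (reverse-++ r u)) (cong reverse r++u≡v)

  ProperPrefix⇒ProperSuffix-reverse : {u v : List X} → ProperPrefix u v →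
    ProperSuffix (reverse u) (reverse v)
  ProperPrefix⇒ProperSuffix-reverse {u} (r , r≢[] , u++r≡v) =
    reverse r , r≢[] ∘ reverse-injective , trans (sym (reverse-++ u r)) (cong reverse u++r≡v)

  suffixFree-via-reverse : {L L′ : Lang X} → (∀ {u} → L u → L′ (reverse u)) →
    PrefixFree L′ → SuffixFree L
  suffixFree-via-reverse L⇒L′ pf _ _ Lu Lv =
    pf _ _ (L⇒L′ Lu) (L⇒L′ Lv) ∘ ProperSuffix⇒ProperPrefix-reverse

  IsCode⇒∌[] : {L : Lang X} → IsCode L → ¬ L []
  IsCode⇒∌[] code L[] with code [] [ [] ] [] (L[] ∷ []) refl
  ... | ()

  prefixFree⇒IsCode : {L : Lang X} → ¬ L [] → PrefixFree L → IsCode L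
  prefixFree⇒IsCode {L} ∌[] pf = code
    where
    heads-equal : ∀ {u v u′ v′} → L u → L v → u ++ u′ ≡ v ++ v′ → u ≡ v
    heads-equal {u} {v} Lu Lv e with ++-comparable u v _ _ e
    ... | inj₁ ([]    , u++[]≡v) = trans (sym (++-identityʳ u)) u++[]≡v
    ... | inj₁ (c ∷ r , u++r≡v) = ⊥-elim (pf u v Lu Lv (c ∷ r , (λ ()) , u++r≡v))
    ... | inj₂ ([]    , v++[]≡u) = trans (sym v++[]≡u) (++-identityʳ v)
    ... | inj₂ (c ∷ r , v++r≡u) = ⊥-elim (pf v u Lv Lu (c ∷ r , (λ ()) , v++r≡u))

    code : IsCode L
    code []       []       _          _          _ = refl
    code []       (v ∷ vs) _          (Lv ∷ _)   e = ⊥-elim (∌[] (subst L (++-conicalˡ v _ (sym e)) Lv))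
    code (u ∷ us) []       (Lu ∷ _)   _          e = ⊥-elim (∌[] (subst L (++-conicalˡ u _ e) Lu))
    code (u ∷ us) (v ∷ vs) (Lu ∷ Lus) (Lv ∷ Lvs) e with heads-equal Lu Lv e
    ... | refl = cong (u ∷_) (code us vs Lus Lvs (++-cancelˡ u _ _ e))

  mirror : List (List X) → List (List X)
  mirror = reverse ∘ map reverse

  concat-mirror : ∀ ws → concat (mirror ws) ≡ reverse (concat ws)
  concat-mirror []       = refl
  concat-mirror (w ∷ ws) = begin
    concat (reverse (reverse w ∷ map reverse ws)) ≡⟨ cong concat (unfold-reverse (reverse w) (map reverse ws)) ⟩
    concat (mirror ws ++ [ reverse w ])           ≡⟨ sym (concat-++ (mirror ws) [ reverse w ]) ⟩
    concat (mirror ws) ++ reverse w ++ []         ≡⟨ cong₂ _++_ (concat-mirror ws) (++-identityʳ (reverse w)) ⟩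
    reverse (concat ws) ++ reverse w              ≡⟨ sym (reverse-++ w (concat ws)) ⟩
    reverse (w ++ concat ws)                      ∎

  All-mirror : {L : Lang X} {ws : List (List X)} → All L ws → All (L ∘ reverse) (mirror ws)
  All-mirror {L} Lws = All.tabulate (All.lookup (map⁺ (All.map Lreverse Lws)) ∘ Any.reverse⁻)
    where
    Lreverse : ∀ {w} → L w → L (reverse (reverse w))
    Lreverse {w} = subst L (sym (reverse-involutive w))

  mirror-injective : ∀ {ws vs} → mirror ws ≡ mirror vs → ws ≡ vs
  mirror-injective = map-injective reverse-injective ∘ reverse-injective

  suffixFree⇒IsCode : {L : Lang X} → ¬ L [] → SuffixFree L → IsCode L
  suffixFree⇒IsCode {L} ∌[] sf ws vs Lws Lvs e =
    mirror-injective (prefixFree⇒IsCode ∌[] pf (mirror ws) (mirror vs) (All-mirror Lws) (All-mirror Lvs)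
      (trans (concat-mirror ws) (trans (cong reverse e) (sym (concat-mirror vs)))))
    where
    pf : PrefixFree (L ∘ reverse)
    pf u v Lu Lv = sf (reverse u) (reverse v) Lu Lv ∘ ProperPrefix⇒ProperSuffix-reverse

module _ {B : Set} {C₁ C₂ : Lang B} where

  prefixFree⇒IsPrefixCodeOver : (∀ w → C₁ w → InStar C₂ w) → ¬ C₁ [] →
    PrefixFree (Over C₁ C₂) → IsPrefixCodeOver C₁ C₂
  prefixFree⇒IsPrefixCodeOver factor ∌[] pf = (factor , prefixFree⇒IsCode (∌[] ∘ proj₂) pf) , pf

  suffixFree⇒IsSuffixCodeOver : (∀ w → C₁ w → InStar C₂ w) → ¬ C₁ [] →
    SuffixFree (Over C₁ C₂) → IsSuffixCodeOver C₁ C₂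
  suffixFree⇒IsSuffixCodeOver factor ∌[] sf = (factor , suffixFree⇒IsCode (∌[] ∘ proj₂) sf) , sf

  refine : (∀ w → C₁ w → InStar C₂ w) → ∀ {ws} → All C₁ ws →
    Σ[ fs ∈ List (List (List B)) ] All (Over C₁ C₂) fs × map concat fs ≡ ws
  refine factor []         = [] , [] , refl
  refine factor (C₁w ∷ C₁ws) with factor _ C₁w | refine factor C₁ws
  ... | f , C₂f , refl | fs , Ofs , refl = f ∷ fs , (C₂f , C₁w) ∷ Ofs , refl

  IsCodeOver⇒IsCode : IsCode C₂ → IsCodeOver C₁ C₂ → IsCode C₁
  IsCodeOver⇒IsCode code₂ (factor , codeOver) ws vs C₁ws C₁vs e
    with refine factor C₁ws | refine factor C₁vs
  ... | fs , Ofs , refl | gs , Ogs , refl =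
    cong (map concat) (codeOver fs gs Ofs Ogs (code₂ _ _ (C₂-factors Ofs) (C₂-factors Ogs) same-word))
    where
    C₂-factors : ∀ {hs} → All (Over C₁ C₂) hs → All C₂ (concat hs)
    C₂-factors = concat⁺ ∘ All.map proj₁

    same-word : concat (concat fs) ≡ concat (concat gs)
    same-word = trans (sym (concat-concat fs)) (trans e (concat-concat gs))

module _ {X : Set} (x : X) (t : ℕ) (i : X → Fin t → ℕ) where

  YWord : Lang X
  YWord w = w ≡ replicate t x ⊎
    Σ[ y ∈ X ] y ≢ x × Σ[ s ∈ Fin t ] w ≡ replicate (i y s) x ++ y ∷ replicate (toℕ s) x

  YWordᴿ : Lang X
  YWordᴿ w = w ≡ replicate t x ⊎
    Σ[ y ∈ X ] y ≢ x × Σ[ s ∈ Fin t ] w ≡ replicate (toℕ s) x ++ y ∷ replicate (i y s) x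

  YWord⇒YWordᴿ-reverse : ∀ {w} → YWord w → YWordᴿ (reverse w)
  YWord⇒YWordᴿ-reverse (inj₁ refl) = inj₁ (reverse-replicate t x)
  YWord⇒YWordᴿ-reverse (inj₂ (y , y≢x , s , refl)) =
    inj₂ (y , y≢x , s , reverse-replicate-++-∷ (i y s) y x (toℕ s))

  YWordᴿ-prefixFree : PrefixFree YWordᴿ
  YWordᴿ-prefixFree _ _ (inj₁ refl) (inj₁ refl) (r , r≢[] , e) =
    r≢[] (++-identityʳ-unique (replicate t x) (sym e))
  YWordᴿ-prefixFree _ _ (inj₁ refl) (inj₂ (y , y≢x , s , refl)) (r , _ , e) =
    replicate-++≢replicate-++-∷ y≢x r _ (toℕ<n s) e
  YWordᴿ-prefixFree _ _ (inj₂ (y , y≢x , s , refl)) (inj₁ refl) (r , _ , e) =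
    replicate≢replicate-++-∷ y≢x t (toℕ s) _
      (trans (sym e) (++-assoc (replicate (toℕ s) x) (y ∷ replicate (i y s) x) r))
  YWordᴿ-prefixFree _ _ (inj₂ (y , y≢x , s , refl)) (inj₂ (y′ , y′≢x , s′ , refl)) (r , r≢[] , e)
    with replicate-++-∷-injective y≢x y′≢x (toℕ s) (toℕ s′) _ _
           (trans (sym (++-assoc (replicate (toℕ s) x) (y ∷ replicate (i y s) x) r)) e)
  ... | s≡s′ , refl , Aⁱ++r≡Aⁱ′ with toℕ-injective s≡s′
  ... | refl = r≢[] (++-identityʳ-unique (replicate (i y s) x) (sym Aⁱ++r≡Aⁱ′))

  YWord-suffixFree : SuffixFree YWord
  YWord-suffixFree = suffixFree-via-reverse YWord⇒YWordᴿ-reverse YWordᴿ-prefixFree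

module Construction {B : Set} (a : B) (C : Lang B) (n t : ℕ) (code : IsCode C) (C-A : C (pow a n))
  (n≥1 : n ≥ 1) (t≥1 : t ≥ 1) (i j : List B → Fin t → ℕ) where

  A Aᵗ : List B
  A  = pow a n
  Aᵗ = pow a (n * t)

  y : List B → Fin t → List B
  y ω s = pow a (n * i ω s) ++ ω ++ pow a (n * toℕ s)

  Y : Lang B
  Y w = w ≡ Aᵗ ⊎ Σ[ ω ∈ List B ] C ω × ω ≢ A × Σ[ s ∈ Fin t ] w ≡ y ω s

  X : Lang B
  X = TheSet a C n t i j

  concat-replicate-A : ∀ k → concat (replicate k A) ≡ pow a (n * k)
  concat-replicate-A k = concat-replicate n k a

  yᶜ : List B → Fin t → List (List B)
  yᶜ ω s = replicate (i ω s) A ++ ω ∷ replicate (toℕ s) A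

  concat-yᶜ : ∀ ω s → concat (yᶜ ω s) ≡ y ω s
  concat-yᶜ ω s = begin
    concat (replicate (i ω s) A ++ ω ∷ replicate (toℕ s) A)
      ≡⟨ sym (concat-++ (replicate (i ω s) A) (ω ∷ replicate (toℕ s) A)) ⟩
    concat (replicate (i ω s) A) ++ ω ++ concat (replicate (toℕ s) A)
      ≡⟨ cong₂ (λ u v → u ++ ω ++ v) (concat-replicate-A (i ω s)) (concat-replicate-A (toℕ s)) ⟩
    y ω s
      ∎

  All-C-yᶜ : ∀ {ω} s → C ω → All C (yᶜ ω s)
  All-C-yᶜ {ω} s Cω = ++⁺ (replicate⁺ (i ω s) C-A) (Cω ∷ replicate⁺ (toℕ s) C-A)

  Aᵗ≢[] : Aᵗ ≢ []
  Aᵗ≢[] = pow≢[] (*-mono-≤ n≥1 t≥1)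
    where
    pow≢[] : ∀ {k} → k ≥ 1 → pow a k ≢ []
    pow≢[] (s≤s _) ()

  ++-infix≢[] : ∀ {ω} u v → C ω → u ++ ω ++ v ≢ []
  ++-infix≢[] u v Cω e = IsCode⇒∌[] code (subst C (++-conicalˡ _ v (++-conicalʳ u _ e)) Cω)

  Y∌[] : ¬ Y []
  Y∌[] (inj₁ e)                   = Aᵗ≢[] (sym e)
  Y∌[] (inj₂ (ω , Cω , _ , s , e)) = ++-infix≢[] (pow a (n * i ω s)) _ Cω (sym e)

  X∌[] : ¬ X []
  X∌[] (inj₁ e)                   = Aᵗ≢[] (sym e)
  X∌[] (inj₂ (ω , Cω , _ , s , e)) = ++-infix≢[] (pow a (n * i ω s)) _ Cω (sym e)

  Y⊆C* : ∀ w → Y w → InStar C w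
  Y⊆C* _ (inj₁ refl)                   = replicate t A , replicate⁺ t C-A , concat-replicate-A t
  Y⊆C* _ (inj₂ (ω , Cω , _ , s , refl)) = yᶜ ω s , All-C-yᶜ s Cω , concat-yᶜ ω s

  Over-Y⇒YWord : ∀ {f} → Over Y C f → YWord A t i f
  Over-Y⇒YWord (Cf , inj₁ e) =
    inj₁ (code _ _ Cf (replicate⁺ t C-A) (trans e (sym (concat-replicate-A t))))
  Over-Y⇒YWord (Cf , inj₂ (ω , Cω , ω≢A , s , e)) =
    inj₂ (ω , ω≢A , s , code _ _ Cf (All-C-yᶜ s Cω) (trans e (sym (concat-yᶜ ω s))))

  Y-suffixCode : IsSuffixCodeOver Y C
  Y-suffixCode = suffixFree⇒IsSuffixCodeOver Y⊆C* Y∌[]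
    (λ u v Ou Ov → YWord-suffixFree A t i u v (Over-Y⇒YWord Ou) (Over-Y⇒YWord Ov))

  Y-code : IsCode Y
  Y-code = IsCodeOver⇒IsCode code (proj₁ Y-suffixCode)

  y≢Aᵗ : ∀ {ω} s → C ω → ω ≢ A → y ω s ≢ Aᵗ
  y≢Aᵗ {ω} s Cω ω≢A e = replicate≢replicate-++-∷ ω≢A t (i ω s) _
    (code _ _ (replicate⁺ t C-A) (All-C-yᶜ s Cω)
      (trans (concat-replicate-A t) (trans (sym e) (sym (concat-yᶜ ω s)))))

  y-injective : ∀ {ω ω′} s s′ → C ω → C ω′ → ω ≢ A → ω′ ≢ A → y ω s ≡ y ω′ s′ → ω ≡ ω′ × s ≡ s′
  y-injective {ω} {ω′} s s′ Cω Cω′ ω≢A ω′≢A e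
    with replicate-++-∷-injective ω≢A ω′≢A (i ω s) (i ω′ s′) _ _
           (code _ _ (All-C-yᶜ s Cω) (All-C-yᶜ s′ Cω′)
             (trans (concat-yᶜ ω s) (trans e (sym (concat-yᶜ ω′ s′)))))
  ... | _ , ω≡ω′ , Aˢ≡Aˢ′ = ω≡ω′ , toℕ-injective (begin
    toℕ s                            ≡⟨ sym (length-replicate (toℕ s)) ⟩
    length (replicate (toℕ s) A)     ≡⟨ cong length Aˢ≡Aˢ′ ⟩
    length (replicate (toℕ s′) A)    ≡⟨ length-replicate (toℕ s′) ⟩
    toℕ s′                           ∎)

  xʸ : List B → Fin t → List (List B)
  xʸ ω s = y ω s ∷ replicate (j ω s) Aᵗ

  pow-+-replicate-Aᵗ : ∀ s k → pow a (n * s) ++ concat (replicate k Aᵗ) ≡ pow a (n * (s + t * k))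
  pow-+-replicate-Aᵗ s k = begin
    pow a (n * s) ++ concat (replicate k Aᵗ)  ≡⟨ cong (pow a (n * s) ++_) (concat-replicate (n * t) k a) ⟩
    pow a (n * s) ++ pow a (n * t * k)         ≡⟨ sym (replicate-+ (n * s) (n * t * k) a) ⟩
    pow a (n * s + n * t * k)                  ≡⟨ cong (λ m → pow a (n * s + m)) (*-assoc n t k) ⟩
    pow a (n * s + n * (t * k))                ≡⟨ cong (pow a) (sym (*-distribˡ-+ n s (t * k))) ⟩
    pow a (n * (s + t * k))                    ∎

  concat-xʸ : ∀ ω s → concat (xʸ ω s) ≡ pow a (n * i ω s) ++ ω ++ pow a (n * (toℕ s + t * j ω s))
  concat-xʸ ω s = begin
    (P ++ ω ++ Q) ++ R  ≡⟨ ++-assoc P (ω ++ Q) R ⟩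
    P ++ (ω ++ Q) ++ R  ≡⟨ cong (P ++_) (++-assoc ω Q R) ⟩
    P ++ ω ++ Q ++ R    ≡⟨ cong (λ v → P ++ ω ++ v) (pow-+-replicate-Aᵗ (toℕ s) (j ω s)) ⟩
    P ++ ω ++ pow a (n * (toℕ s + t * j ω s)) ∎
    where
    P Q R : List B
    P = pow a (n * i ω s)
    Q = pow a (n * toℕ s)
    R = concat (replicate (j ω s) Aᵗ)

  All-Y-xʸ : ∀ {ω} s → C ω → ω ≢ A → All Y (xʸ ω s)
  All-Y-xʸ {ω} s Cω ω≢A = inj₂ (ω , Cω , ω≢A , s , refl) ∷ replicate⁺ (j ω s) (inj₁ refl)

  X⊆Y* : ∀ w → X w → InStar Y w
  X⊆Y* _ (inj₁ refl)                     = [ Aᵗ ] , inj₁ refl ∷ [] , ++-identityʳ Aᵗ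
  X⊆Y* _ (inj₂ (ω , Cω , ω≢A , s , refl)) = xʸ ω s , All-Y-xʸ s Cω ω≢A , concat-xʸ ω s

  XWord : Lang (List B)
  XWord g = g ≡ [ Aᵗ ] ⊎ Σ[ ω ∈ List B ] C ω × ω ≢ A × Σ[ s ∈ Fin t ] g ≡ xʸ ω s

  Over-X⇒XWord : ∀ {g} → Over X Y g → XWord g
  Over-X⇒XWord (Yg , inj₁ e) =
    inj₁ (Y-code _ _ Yg (inj₁ refl ∷ []) (trans e (sym (++-identityʳ Aᵗ))))
  Over-X⇒XWord (Yg , inj₂ (ω , Cω , ω≢A , s , e)) =
    inj₂ (ω , Cω , ω≢A , s , Y-code _ _ Yg (All-Y-xʸ s Cω ω≢A) (trans e (sym (concat-xʸ ω s))))

  XWord-prefixFree : PrefixFree XWord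
  XWord-prefixFree _ _ (inj₁ refl) (inj₁ refl) (r , r≢[] , e) = r≢[] (∷-injectiveʳ e)
  XWord-prefixFree _ _ (inj₁ refl) (inj₂ (ω , Cω , ω≢A , s , refl)) (_ , _ , e) =
    y≢Aᵗ s Cω ω≢A (sym (∷-injectiveˡ e))
  XWord-prefixFree _ _ (inj₂ (ω , Cω , ω≢A , s , refl)) (inj₁ refl) (_ , _ , e) =
    y≢Aᵗ s Cω ω≢A (∷-injectiveˡ e)
  XWord-prefixFree _ _ (inj₂ (ω , Cω , ω≢A , s , refl)) (inj₂ (ω′ , Cω′ , ω′≢A , s′ , refl)) (r , r≢[] , e)
    with y-injective s s′ Cω Cω′ ω≢A ω′≢A (∷-injectiveˡ e)
  ... | refl , refl = r≢[] (++-identityʳ-unique (replicate (j ω s) Aᵗ) (sym (∷-injectiveʳ e)))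

  X-prefixCode : IsPrefixCodeOver X Y
  X-prefixCode = prefixFree⇒IsPrefixCodeOver X⊆Y* X∌[]
    (λ u v Ou Ov → XWord-prefixFree u v (Over-X⇒XWord Ou) (Over-X⇒XWord Ov))

mainTheorem19 : {𝒜 : Set} (a : 𝒜) (C : Lang 𝒜) (n t : ℕ) →
    IsCode C → C (pow a n) → n ≥ 1 → t ≥ 1 →
    (i j : List 𝒜 → Fin t → ℕ) →
    PSCode C (TheSet a C n t i j)
mainTheorem19 a C n t code C-A n≥1 t≥1 i j =
  pre (suf (base (λ _ Cw → Cw) (λ _ Cw → Cw)) Y-suffixCode) X-prefixCode
  where open Construction a C n t code C-A n≥1 t≥1 i j
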